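{- Let $P_H$ be a standard parabolic subgroup of $H=\mathrm{GL}_n$. Then $\{Q\in\mathcal{F}_{\mathrm{RS}}\mid Q\cap H=P_H\}=\{Q\subset G \text{ semi-standard parabolic}\mid \mathfrak{a}_Q^+\cap\mathfrak{a}_{P_H}^+\neq\emptyset\}$, where the intersection is taken in $\mathfrak{a}_0$.
   Context: $G=\mathrm{GL}_n\times\mathrm{GL}_{n+1}$, $H\simeq\mathrm{GL}_n$ embedded diagonally by $h\mapsto(h,\mathrm{diag}(h,1))$. Standard means containing the product $P_0$ of upper triangular Borel subgroups (for $H$: the upper triangular Borel of $\mathrm{GL}_n$); semi-standard means containing the product $T_0$ of diagonal tori. $\mathcal{F}_{\mathrm{RS}}$ is the set of semi-standard $Q=Q_n\times Q_{n+1}\subset G$ with $Q_n$ standard and $Q_n=Q_{n+1}\cap\mathrm{GL}_n$ (so $Q\cap H=Q_n$). $\mathfrak{a}_0=\mathbb{R}^n\oplus\mathbb{R}^{n+1}$ is the real Lie algebra of cocharacters of $T_0$; for a semi-standard parabolic $Q$ with Levi $M_Q\supset T_0$, $\mathfrak{a}_Q\subset\mathfrak{a}_0$ is the subspace of vectors constant on the coordinates of each diagonal block of $M_Q$, and $\mathfrak{a}_Q^+=\{X\in\mathfrak{a}_Q\mid \alpha(X)>0$ for every root $\alpha$ of $T_0$ occurring in the unipotent radical $N_Q\}$ (for the root of entry $(a,b)$, $\alpha(X)=X_a-X_b$ in the relevant factor). $\mathfrak{a}_{0,H}=\{(x,(x,0))\mid x\in\mathbb{R}^n\}\subset\mathfrak{a}_0$,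 identified with $\mathbb{R}^n$, and $\mathfrak{a}_{P_H}^+\subset\mathfrak{a}_{0,H}$ is the positive chamber of $P_H$: vectors $x$ constant on each block of $P_H$ with values strictly decreasing from one block to the next.
   Formalization: The space $\mathfrak{a}_0$ is taken over ℚ rather than ℝ, so the chambers $\mathfrak{a}_Q^+$ and $\mathfrak{a}_{P_H}^+$ and the points of their intersection have rational coordinates. -}

module Defs where

open import Data.Nat using (ℕ; zero; suc)
open import Data.Fin using (Fin; zero; suc; toℕ; inject₁)
open import Data.Bool using (Bool; true; false; _∧_)
open import Data.Rational using (ℚ; 0ℚ; _<_)
open import Data.Product using (_×_; _,_; proj₁; proj₂)
open import Data.Sum using (_⊎_)
open import Relation.Binary.PropositionalEquality using (_≡_)
import Data.Nat as ℕ

-- A semi-standard parabolic subgroup P of GL_m (i.e. P ⊇ diagonal torus T_0)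
-- is encoded by its "entry pattern": rel a b ≡ true iff the (a,b) matrix
-- entry is allowed in P (i.e. a = b or the root space of e_a - e_b lies in P).
-- Such patterns are exactly the total preorders on {0..m-1}; two parabolics
-- are equal iff their patterns agree pointwise.
record SSParabolic (m : ℕ) : Set where
  field
    rel        : Fin m → Fin m → Bool
    reflexive  : ∀ a → rel a a ≡ true
    transitive : ∀ a b c → rel a b ≡ true → rel b c ≡ true → rel a c ≡ true
    total      : ∀ a b → rel a b ≡ true ⊎ rel b a ≡ true

open SSParabolic public

-- Standard: contains the upper triangular Borel subgroup.
Standard : ∀ {m} → SSParabolic m → Set
Standard P = ∀ a b → toℕ a ℕ.< toℕ b → rel P a b ≡ true

-- Semi-standard parabolic subgroups of G = GL_n × GL_{n+1}.
GParabolic : ℕ → Set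
GParabolic n = SSParabolic n × SSParabolic (suc n)

-- Q ∈ F_RS : Q_n standard and Q_n = Q_{n+1} ∩ GL_n (GL_n in the upper-left corner).
InFRS : ∀ {n} → GParabolic n → Set
InFRS (Qn , Qn1) =
  Standard Qn × (∀ a b → rel Qn a b ≡ rel Qn1 (inject₁ a) (inject₁ b))

-- Entry pattern of Q ∩ H ⊂ H = GL_n, H embedded by h ↦ (h, diag(h,1)).
capH : ∀ {n} → GParabolic n → Fin n → Fin n → Bool
capH (Qn , Qn1) a b = rel Qn a b ∧ rel Qn1 (inject₁ a) (inject₁ b)

CapHEq : ∀ {n} → GParabolic n → SSParabolic n → Set
CapHEq Q PH = ∀ a b → capH Q a b ≡ rel PH a b

-- X ∈ 𝔞_P^+ : X constant on each diagonal block of the Levi M_P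
-- (a ~ b iff rel a b and rel b a), and α(X) = X_a - X_b > 0 for each root
-- (a,b) occurring in the unipotent radical N_P (rel a b true, rel b a false).
InChamber : ∀ {m} → SSParabolic m → (Fin m → ℚ) → Set
InChamber P X =
  (∀ a b → rel P a b ≡ true → rel P b a ≡ true → X a ≡ X b) ×
  (∀ a b → rel P a b ≡ true → rel P b a ≡ false → X b < X a)

InChamberG : ∀ {n} → GParabolic n → (Fin n → ℚ) × (Fin (suc n) → ℚ) → Set
InChamberG (Qn , Qn1) (X , Y) = InChamber Qn X × InChamber Qn1 Y

extend0 : ∀ {n} → (Fin n → ℚ) → Fin (suc n) → ℚ
extend0 {zero}  x zero    = 0ℚ
extend0 {suc n} x zero    = x zero
extend0 {suc n} x (suc i) = extend0 (λ j → x (suc j)) i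

embH : ∀ {n} → (Fin n → ℚ) → (Fin n → ℚ) × (Fin (suc n) → ℚ)
embH x = x , extend0 x

{-# OPTIONS --safe #-}
module Submission where

-- A vector X lies in 𝔞_P^+ exactly when the preorder "X b ≤ X a" is the entry pattern of P,
-- and every semi-standard P has such a vector, namely X a = #{c | rel P a c}. So a chamber
-- vector determines its parabolic: if x ∈ 𝔞_{P_H}^+ and (x, (x, 0)) ∈ 𝔞_Q^+, then P_H, Q_n
-- and the GL_n-corner of Q_{n+1} all have the pattern of x, which says Q ∈ F_RS and
-- Q ∩ H = P_H. Conversely, a chamber vector of Q_{n+1} shifted to vanish at the last
-- coordinate restricts to a common chamber vector of P_H, Q_n and Q_{n+1}.

open import Defs
open import Data.Nat using (ℕ; zero; suc)
open import Data.Rational using (ℚ; 0ℚ; _≤_; _<_; _-_; *<*)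
open import Data.Fin using (Fin; zero; suc; inject₁; fromℕ)
open import Data.Product using (_×_; ∃; _,_)
open import Function.Bundles using (_⇔_; mk⇔; Equivalence)

open import Data.Bool using (Bool; true; false; _∧_)
open import Data.Bool.Properties using (∧-idem)
open import Data.Fin.Subset using (Subset; _∈_; _⊆_; _⊂_; ∣_∣)
open import Data.Fin.Subset.Properties using (p⊆q⇒∣p∣≤∣q∣; p⊂q⇒∣p∣<∣q∣)
open import Data.Integer as ℤ using (ℤ; +_; +<+)
import Data.Integer.Properties as ℤ
import Data.Nat.Properties as ℕ
open import Data.Rational.Literals using (fromℤ)
open import Data.Rational.Properties
  using (≤-antisym; ≤-reflexive; <⇒≤; ≤-<-trans; <-irrefl; ≰⇒>; +-monoˡ-<; +-inverseʳ)
open import Data.Sum using (inj₁; inj₂)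
open import Data.Vec using (tabulate)
open import Data.Vec.Properties using (lookup∘tabulate; []=⇒lookup; lookup⇒[]=)
open import Function using (_∘_; case_of_)
open import Relation.Binary.PropositionalEquality
open import Relation.Nullary using (¬_)
open import Relation.Nullary.Reflects using (Reflects; ofʸ; ofⁿ; det)

open Equivalence using (to; from)

private
  variable
    A : Set
    m k : ℕ

reflects-true : ∀ {b} → Reflects A b → b ≡ true → A
reflects-true (ofʸ a) _ = a
reflects-true (ofⁿ _) ()

reflects-false : ∀ {b} → Reflects A b → b ≡ false → ¬ A
reflects-false (ofⁿ ¬a) _ = ¬a
reflects-false (ofʸ _) ()

rel-flip : (P : SSParabolic m) {a b : Fin m} → rel P a b ≡ false → rel P b a ≡ true
rel-flip P {a} {b} ab≡false with total P a b
... | inj₁ ab≡true = case trans (sym ab≡false) ab≡true of λ ()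
... | inj₂ ba≡true = ba≡true

inChamber⇔reflects-≤ : (P : SSParabolic m) {X : Fin m → ℚ} →
  InChamber P X ⇔ (∀ a b → Reflects (X b ≤ X a) (rel P a b))
inChamber⇔reflects-≤ P {X} = mk⇔ reflects inChamber
  where
  reflects : InChamber P X → ∀ a b → Reflects (X b ≤ X a) (rel P a b)
  reflects (constant , strict) a b with rel P a b in ab | rel P b a in ba
  ... | true  | true  = ofʸ (≤-reflexive (sym (constant a b ab ba)))
  ... | true  | false = ofʸ (<⇒≤ (strict a b ab ba))
  ... | false | _     = ofⁿ λ Xb≤Xa →
    <-irrefl refl (≤-<-trans Xb≤Xa (strict b a (rel-flip P ab) ab))

  inChamber : (∀ a b → Reflects (X b ≤ X a) (rel P a b)) → InChamber P X
  inChamber r =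
    (λ a b ab ba → ≤-antisym (reflects-true (r b a) ba) (reflects-true (r a b) ab)) ,
    (λ a b _ ba → ≰⇒> (reflects-false (r b a) ba))

inChamber-restrict : (P : SSParabolic m) (R : SSParabolic k) {g : Fin m → Fin k}
  {X : Fin m → ℚ} {Y : Fin k → ℚ} → InChamber R Y → Y ∘ g ≗ X →
  InChamber P X ⇔ (∀ a b → rel P a b ≡ rel R (g a) (g b))
inChamber-restrict P R {g} {X} {Y} chR Y∘g≗X = mk⇔
  (λ chP a b → det (to (inChamber⇔reflects-≤ P) chP a b) (reflectsR a b))
  (λ P≡R → from (inChamber⇔reflects-≤ P)
    λ a b → subst (Reflects _) (sym (P≡R a b)) (reflectsR a b))
  where
  reflectsR : ∀ a b → Reflects (X b ≤ X a) (rel R (g a) (g b))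
  reflectsR a b = subst₂ (λ u v → Reflects (u ≤ v) _) (Y∘g≗X b) (Y∘g≗X a)
    (to (inChamber⇔reflects-≤ R) chR (g a) (g b))

fromℤ-mono-< : {i j : ℤ} → i ℤ.< j → fromℤ i < fromℤ j
fromℤ-mono-< {i} {j} i<j =
  *<* (subst₂ ℤ._<_ (sym (ℤ.*-identityʳ i)) (sym (ℤ.*-identityʳ j)) i<j)

∈-tabulate⁺ : {f : Fin m → Bool} {c : Fin m} → f c ≡ true → c ∈ tabulate f
∈-tabulate⁺ {f = f} {c} fc = lookup⇒[]= c (tabulate f) (trans (lookup∘tabulate f c) fc)

∈-tabulate⁻ : {f : Fin m → Bool} {c : Fin m} → c ∈ tabulate f → f c ≡ true
∈-tabulate⁻ {f = f} {c} c∈f = trans (sym (lookup∘tabulate f c)) ([]=⇒lookup c∈f)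

upperSet : SSParabolic m → Fin m → Subset m
upperSet P a = tabulate (rel P a)

upperSet-⊆ : (P : SSParabolic m) {a b : Fin m} →
  rel P a b ≡ true → upperSet P b ⊆ upperSet P a
upperSet-⊆ P {a} {b} ab c∈ = ∈-tabulate⁺ (transitive P a b _ ab (∈-tabulate⁻ c∈))

upperSet-⊂ : (P : SSParabolic m) {a b : Fin m} →
  rel P a b ≡ true → rel P b a ≡ false → upperSet P b ⊂ upperSet P a
upperSet-⊂ P {a} ab ba =
  upperSet-⊆ P ab , a , ∈-tabulate⁺ (reflexive P a) ,
  λ a∈ → case trans (sym ba) (∈-tabulate⁻ a∈) of λ ()

chamberVector : SSParabolic m → Fin m → ℚ
chamberVector P a = fromℤ (+ ∣ upperSet P a ∣)

chamberVector-inChamber : (P : SSParabolic m) → InChamber P (chamberVector P)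
chamberVector-inChamber P =
  (λ a b ab ba → cong (fromℤ ∘ +_)
    (ℕ.≤-antisym (p⊆q⇒∣p∣≤∣q∣ (upperSet-⊆ P ba)) (p⊆q⇒∣p∣≤∣q∣ (upperSet-⊆ P ab)))) ,
  (λ a b ab ba → fromℤ-mono-< (+<+ (p⊂q⇒∣p∣<∣q∣ (upperSet-⊂ P ab ba))))

inChamber-translate : (P : SSParabolic m) {X : Fin m → ℚ} → InChamber P X →
  (r : ℚ) → InChamber P (λ i → X i - r)
inChamber-translate P (constant , strict) r =
  (λ a b ab ba → cong (_- r) (constant a b ab ba)) ,
  (λ a b ab ba → +-monoˡ-< _ (strict a b ab ba))

inChamber-vanishingAt : (P : SSParabolic m) (c : Fin m) →
  ∃ λ (Y : Fin m → ℚ) → InChamber P Y × Y c ≡ 0ℚ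
inChamber-vanishingAt P c =
  (λ i → chamberVector P i - chamberVector P c) ,
  inChamber-translate P (chamberVector-inChamber P) (chamberVector P c) ,
  +-inverseʳ (chamberVector P c)

extend0-inject₁ : {n : ℕ} (x : Fin n → ℚ) → extend0 x ∘ inject₁ ≗ x
extend0-inject₁ {suc n} x zero    = refl
extend0-inject₁ {suc n} x (suc a) = extend0-inject₁ (x ∘ suc) a

extend0-∘inject₁ : (n : ℕ) (Y : Fin (suc n) → ℚ) → Y (fromℕ n) ≡ 0ℚ →
  Y ≗ extend0 (Y ∘ inject₁)
extend0-∘inject₁ zero    Y Y₀≡0 zero    = Y₀≡0
extend0-∘inject₁ (suc n) Y Y₀≡0 zero    = refl
extend0-∘inject₁ (suc n) Y Y₀≡0 (suc i) = extend0-∘inject₁ n (Y ∘ suc) Y₀≡0 i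

capH-compatible : {n : ℕ} (Qn : SSParabolic n) (Qn1 : SSParabolic (suc n)) →
  (∀ a b → rel Qn a b ≡ rel Qn1 (inject₁ a) (inject₁ b)) →
  ∀ a b → capH (Qn , Qn1) a b ≡ rel Qn a b
capH-compatible Qn Qn1 compatible a b =
  trans (cong (rel Qn a b ∧_) (sym (compatible a b))) (∧-idem (rel Qn a b))

lemma4p4 : (n : ℕ) (PH : SSParabolic n) → Standard PH →
    (Q : GParabolic n) →
    (InFRS Q × CapHEq Q PH) ⇔
      (∃ λ (x : Fin n → ℚ) → InChamber PH x × InChamberG Q (embH x))
lemma4p4 n PH standard (Qn , Qn1) = mk⇔ frs⇒chamber chamber⇒frs
  where
  frs⇒chamber : InFRS (Qn , Qn1) × CapHEq (Qn , Qn1) PH →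
    ∃ λ x → InChamber PH x × InChamberG (Qn , Qn1) (embH x)
  frs⇒chamber ((_ , compatible) , cap)
    with Y , chY , Y-last≡0 ← inChamber-vanishingAt Qn1 (fromℕ n) =
    Y ∘ inject₁ , chPH , chQn , chQn1
    where
    chQn : InChamber Qn (Y ∘ inject₁)
    chQn = from (inChamber-restrict Qn Qn1 chY (λ _ → refl)) compatible
    chPH : InChamber PH (Y ∘ inject₁)
    chPH = from (inChamber-restrict PH Qn chQn (λ _ → refl))
      λ a b → trans (sym (cap a b)) (capH-compatible Qn Qn1 compatible a b)
    chQn1 : InChamber Qn1 (extend0 (Y ∘ inject₁))
    chQn1 = from (inChamber-restrict Qn1 Qn1 chY (extend0-∘inject₁ n Y Y-last≡0))
      λ _ _ → refl

  chamber⇒frs : (∃ λ x → InChamber PH x × InChamberG (Qn , Qn1) (embH x)) →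
    InFRS (Qn , Qn1) × CapHEq (Qn , Qn1) PH
  chamber⇒frs (x , chPH , chQn , chQn1) =
    ((λ a b a<b → trans (sym (PH≡Qn a b)) (standard a b a<b)) , compatible) ,
    λ a b → trans (capH-compatible Qn Qn1 compatible a b) (sym (PH≡Qn a b))
    where
    PH≡Qn : ∀ a b → rel PH a b ≡ rel Qn a b
    PH≡Qn = to (inChamber-restrict PH Qn chQn (λ _ → refl)) chPH
    compatible : ∀ a b → rel Qn a b ≡ rel Qn1 (inject₁ a) (inject₁ b)
    compatible = to (inChamber-restrict Qn Qn1 chQn1 (extend0-inject₁ x)) chQn
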